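{- Given a proof in $\mathsf{LLM}$ of a sequent $\vDash\Upsilon:\Psi,[P]$ there exists: (1) a proof of the sequent $\vDash\Upsilon:\Sigma,[P]$, for some suitable spent context $\Sigma$, and (2) for any $\Delta$, an open derivation from $\vDash\Upsilon:\Sigma,\Delta$ to $\vDash\Upsilon:\Psi,\Delta$. The combined height of these two derivations is exactly the height of the input derivation.
   Context: $\mathsf{LLM}$ is a multifocused sequent calculus for full linear logic over a polarised syntax. Positive formulas: $P,Q ::= a \mid 1 \mid P\otimes Q \mid 0 \mid P\oplus Q \mid\ !N \mid\ \downarrow N$. Negative formulas: $N,M ::= a^\perp \mid \bot \mid N \mathbin{⅋} M \mid \top \mid N \mathbin{\&} M \mid\ ?P \mid\ \uparrow P$. Here $\downarrow$ and $\uparrow$ are the polarity shifts, and $P^\perp$ is linear duality. $\Gamma,\Delta$ range over multisets of negative formulas; $\Psi,\Xi$ range over multisets of negative formulas and focused positive formulas $[P]$; $\Theta$ and the persistent context $\Upsilon$ are multisets of positive formulas. There are two sequent forms: $\vdash\Upsilon:\Gamma$ (inversion phase) and $\vDash\Upsilon:\Psi$ (focusing phase). Rules: axiom $\vDash\Upsilon:a^\perp,[a]$; $\downarrow$ rule: from $\vdash\Upsilon:\Gamma,\Delta$ infer $\vDash\Upsilon:\Gamma,[\downarrow\Delta]$ (all foci blurred at once, $\Delta$ non-empty); decision rule $\uparrow$: from $\vDash\Upsilon:[\Upsilon^{\vec n}],\Psi,[\Theta]$ infer $\vdash\Upsilon:\Psi,\uparrow\Theta$ ($\Upsilon^{\vec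 n}$ = arbitrary numbers of copies of formulas of $\Upsilon$; $\Upsilon^{\vec n}$ or $\Theta$ non-empty); $\bot$, $\mathbin{⅋}$, $\top$, $\mathbin{\&}$ are the usual invertible rules in $\vdash$ sequents; $?$: from $\vdash\Upsilon,P:\Gamma$ infer $\vdash\Upsilon:\Gamma,?P$; $1$: $\vDash\Upsilon:[1]$; $\otimes$: from $\vDash\Upsilon:\Psi,[P]$ and $\vDash\Upsilon:\Xi,[Q]$ infer $\vDash\Upsilon:\Psi,\Xi,[P\otimes Q]$; $\oplus_L/\oplus_R$: from $\vDash\Upsilon:\Psi,[P]$ (resp. $[Q]$) infer $\vDash\Upsilon:\Psi,[P\oplus Q]$; $!$: from $\vdash\Upsilon:N$ infer $\vDash\Upsilon:[!N]$. A spent context is $\Sigma ::= \Gamma \mid \Sigma,[\downarrow N]$, i.e. it may contain foci but only on shifted negatives $\downarrow N$ (no active foci). -}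

module Defs where

open import Data.Nat using (ℕ; zero; suc; _+_; _⊔_)
open import Data.List using (List; []; _∷_; _++_; map)
open import Data.List.Membership.Propositional using (_∈_)
open import Data.List.Relation.Unary.All using (All)
open import Data.List.Relation.Binary.Permutation.Propositional using (_↭_)
open import Data.Product using (_×_)
open import Data.Empty using (⊥)
open import Relation.Binary.PropositionalEquality using (_≡_; _≢_)

Atom : Set
Atom = ℕ

mutual
  data Pos : Set where
    atom  : Atom → Pos
    𝟏     : Pos
    _⊗_   : Pos → Pos → Pos
    𝟎     : Pos
    _⊕_   : Pos → Pos → Pos
    !_    : Neg → Pos
    ↓_    : Neg → Pos

  data Neg : Set where
    natom : Atom → Neg
    ⊥'    : Neg
    _⅋_   : Neg → Neg → Neg
    ⊤'    : Neg
    _&_   : Neg → Neg → Neg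
    ¿_    : Pos → Neg
    ↑_    : Pos → Neg

-- Elements of focusing-phase contexts Ψ: a negative formula, or a focused
-- positive formula [P].
data Item : Set where
  neg : Neg → Item
  foc : Pos → Item

-- Multisets are represented by lists; every rule conclusion is taken up to
-- permutation (_↭_).  Derivations are indexed by their height, and are
-- parameterised by a predicate Hyp of admissible hypothesis (open) leaves of
-- focusing-phase form  ⊨ Υ : Ψ.
mutual
  data ⊢[_∣_]_∶_ (Hyp : List Pos → List Item → Set) : ℕ → List Pos → List Neg → Set where
    decide : ∀ {h Υ Γ Γ'} (Φ Θ : List Pos) →
             All (_∈ Υ) Φ →                    -- Φ = Υ^n (copies of formulas of Υ)
             Φ ++ Θ ≢ [] →
             ⊨[ Hyp ∣ h ] Υ ∶ (map foc Φ ++ map neg Γ ++ map foc Θ) →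
             Γ' ↭ Γ ++ map ↑_ Θ →
             ⊢[ Hyp ∣ suc h ] Υ ∶ Γ'
    bot    : ∀ {h Υ Γ Γ'} →
             ⊢[ Hyp ∣ h ] Υ ∶ Γ →
             Γ' ↭ ⊥' ∷ Γ →
             ⊢[ Hyp ∣ suc h ] Υ ∶ Γ'
    par    : ∀ {h Υ Γ Γ' N M} →
             ⊢[ Hyp ∣ h ] Υ ∶ (N ∷ M ∷ Γ) →
             Γ' ↭ (N ⅋ M) ∷ Γ →
             ⊢[ Hyp ∣ suc h ] Υ ∶ Γ'
    top    : ∀ {Υ Γ Γ'} →
             Γ' ↭ ⊤' ∷ Γ →
             ⊢[ Hyp ∣ 1 ] Υ ∶ Γ'
    with'  : ∀ {h₁ h₂ Υ Γ Γ' N M} →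
             ⊢[ Hyp ∣ h₁ ] Υ ∶ (N ∷ Γ) →
             ⊢[ Hyp ∣ h₂ ] Υ ∶ (M ∷ Γ) →
             Γ' ↭ (N & M) ∷ Γ →
             ⊢[ Hyp ∣ suc (h₁ ⊔ h₂) ] Υ ∶ Γ'
    quest  : ∀ {h Υ Γ Γ' P} →
             ⊢[ Hyp ∣ h ] (P ∷ Υ) ∶ Γ →
             Γ' ↭ (¿ P) ∷ Γ →
             ⊢[ Hyp ∣ suc h ] Υ ∶ Γ'

  data ⊨[_∣_]_∶_ (Hyp : List Pos → List Item → Set) : ℕ → List Pos → List Item → Set where
    hyp    : ∀ {Υ Ψ} → Hyp Υ Ψ → ⊨[ Hyp ∣ 0 ] Υ ∶ Ψ
    ax     : ∀ {Υ Ψ} a →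
             Ψ ↭ neg (natom a) ∷ foc (atom a) ∷ [] →
             ⊨[ Hyp ∣ 1 ] Υ ∶ Ψ
    down   : ∀ {h Υ Ψ} (Γ Δ : List Neg) →
             Δ ≢ [] →
             ⊢[ Hyp ∣ h ] Υ ∶ (Γ ++ Δ) →
             Ψ ↭ map neg Γ ++ map (λ N → foc (↓ N)) Δ →
             ⊨[ Hyp ∣ suc h ] Υ ∶ Ψ
    one    : ∀ {Υ Ψ} →
             Ψ ↭ foc 𝟏 ∷ [] →
             ⊨[ Hyp ∣ 1 ] Υ ∶ Ψ
    tensor : ∀ {h₁ h₂ Υ Ψ Ξ Ψ' P Q} →
             ⊨[ Hyp ∣ h₁ ] Υ ∶ (foc P ∷ Ψ) →
             ⊨[ Hyp ∣ h₂ ] Υ ∶ (foc Q ∷ Ξ) →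
             Ψ' ↭ foc (P ⊗ Q) ∷ (Ψ ++ Ξ) →
             ⊨[ Hyp ∣ suc (h₁ + h₂) ] Υ ∶ Ψ'
    plusL  : ∀ {h Υ Ψ Ψ' P Q} →
             ⊨[ Hyp ∣ h ] Υ ∶ (foc P ∷ Ψ) →
             Ψ' ↭ foc (P ⊕ Q) ∷ Ψ →
             ⊨[ Hyp ∣ suc h ] Υ ∶ Ψ'
    plusR  : ∀ {h Υ Ψ Ψ' P Q} →
             ⊨[ Hyp ∣ h ] Υ ∶ (foc Q ∷ Ψ) →
             Ψ' ↭ foc (P ⊕ Q) ∷ Ψ →
             ⊨[ Hyp ∣ suc h ] Υ ∶ Ψ'
    bang   : ∀ {h Υ Ψ N} →
             ⊢[ Hyp ∣ h ] Υ ∶ (N ∷ []) →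
             Ψ ↭ foc (! N) ∷ [] →
             ⊨[ Hyp ∣ suc h ] Υ ∶ Ψ

NoHyp : List Pos → List Item → Set
NoHyp _ _ = ⊥

⊨Proof : ℕ → List Pos → List Item → Set
⊨Proof h Υ Ψ = ⊨[ NoHyp ∣ h ] Υ ∶ Ψ

OneHyp : List Pos → List Item → List Pos → List Item → Set
OneHyp Υ S Υ' Ψ = (Υ' ≡ Υ) × (Ψ ↭ S)

OpenDeriv : ℕ → List Pos → List Item → List Item → Set
OpenDeriv h Υ S Ψ = ⊨[ OneHyp Υ S ∣ h ] Υ ∶ Ψ

data SpentItem : Item → Set where
  s-neg  : ∀ N → SpentItem (neg N)
  s-down : ∀ N → SpentItem (foc (↓ N))

Spent : List Item → Set
Spent Σ' = All SpentItem Σ'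

module Submission where

-- A focused proof of  ⊨ Υ : Ψ, [P]  decomposes P by the positive rules
-- (⊗, ⊕, 1, !, axiom) until every focus still open is a shifted negative ↓N.
-- We split such a proof into two pieces, by induction on it: the rules that
-- decompose P itself form a proof of  ⊨ Υ : Σ, [P]  with Σ spent, and the
-- rules that act on the other foci of Ψ form an open derivation from Σ to Ψ.
--
-- That open derivation is represented as a *grafting* (Grafting n Υ Σ Ψ): a
-- transformer turning any derivation of  ⊨ Υ : Σ, Δ  of height k into one of
--  ⊨ Υ : Ψ, Δ  of height k + n, uniformly in the extra context Δ and in the
-- permutation-closed predicate of hypothesis leaves.

open import Defs
open import Data.Nat using (ℕ; _+_; suc)
open import Data.Nat.Properties
  using (+-identityʳ; +-suc; +-assoc; +-comm; +-commutativeSemigroup)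
open import Algebra.Properties.CommutativeSemigroup +-commutativeSemigroup
  using (interchange)
open import Data.List using (List; []; _∷_; _++_; map; [_])
open import Data.List.Relation.Unary.All using (All; universal; tail)
import Data.List.Relation.Unary.All.Properties as All
open import Data.List.Relation.Unary.Any using (here; there)
open import Data.List.Membership.Propositional using (_∈_)
open import Data.List.Membership.Propositional.Properties using (∈-∃++; ∈-map⁻; ∈-++⁻)
open import Data.List.Relation.Binary.Permutation.Propositional
  using (_↭_; ↭-refl; ↭-sym; ↭-trans; prep; swap)
open import Data.List.Relation.Binary.Permutation.Propositional.Properties
  using (shift; shifts; drop-∷; ∈-resp-↭; All-resp-↭; ++⁺ˡ; ++⁺ʳ; ++-assoc; ++-comm)
open import Data.Product using (Σ; ∃; _×_; _,_)
open import Data.Sum using (_⊎_; inj₁; inj₂)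
open import Relation.Binary.PropositionalEquality using (_≡_; refl; sym; trans; cong; cong₂)

pick : ∀ {A : Set} {x : A} {xs : List A} → x ∈ xs → ∃ λ ys → xs ↭ x ∷ ys
pick {x = x} m with ys , zs , refl ← ∈-∃++ m = ys ++ zs , shift x ys zs

swap-out : ∀ {A : Set} {x y : A} {xs ys zs} →
           y ∷ ys ↭ x ∷ xs → ys ↭ x ∷ zs → y ∷ zs ↭ xs
swap-out {x = x} {y} e ρ =
  drop-∷ (↭-trans (swap x y ↭-refl) (↭-trans (prep y (↭-sym ρ)) e))

pick-++ : ∀ {A : Set} {x : A} xs {ys} → x ∈ xs ++ ys →
          (∃ λ xs' → xs ↭ x ∷ xs' × xs ++ ys ↭ x ∷ ys ++ xs') ⊎
          (∃ λ ys' → ys ↭ x ∷ ys' × xs ++ ys ↭ x ∷ xs ++ ys')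
pick-++ {x = x} xs {ys} m with ∈-++⁻ xs m
... | inj₁ mx with xs' , ρ ← pick mx =
  inj₁ (xs' , ρ , ↭-trans (++⁺ʳ ys ρ) (prep x (++-comm xs' ys)))
... | inj₂ my with ys' , ρ ← pick my =
  inj₂ (ys' , ρ , ↭-trans (++⁺ˡ xs ρ) (shift x xs ys'))

spent-negs : ∀ Γ → Spent (map neg Γ)
spent-negs Γ = All.map⁺ (universal s-neg Γ)

spent-down : ∀ Γ Δ → Spent (map neg Γ ++ map (λ N → foc (↓ N)) Δ)
spent-down Γ Δ = All.++⁺ (spent-negs Γ) (All.map⁺ (universal s-down Δ))

spent-remove : ∀ {L x Ψ} → Spent L → L ↭ x ∷ Ψ → Spent Ψ
spent-remove sp e = tail (All-resp-↭ e sp)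

spent-beside-focus : ∀ {Q Γ P Ψ} → foc Q ∷ map neg Γ ↭ foc P ∷ Ψ → Spent Ψ
spent-beside-focus {Γ = Γ} e with ∈-resp-↭ (↭-sym e) (here refl)
... | here refl = All-resp-↭ (drop-∷ e) (spent-negs Γ)
... | there m with ∈-map⁻ neg m
...   | _ , _ , ()

PermClosed : (List Pos → List Item → Set) → Set
PermClosed H = ∀ {Υ Ψ Ψ'} → Ψ ↭ Ψ' → H Υ Ψ → H Υ Ψ'

oneHyp-closed : ∀ {Υ S} → PermClosed (OneHyp Υ S)
oneHyp-closed p (u , q) = u , ↭-trans (↭-sym p) q

permute : ∀ {H h Υ Ψ Ψ'} → PermClosed H → Ψ ↭ Ψ' →
          ⊨[ H ∣ h ] Υ ∶ Ψ → ⊨[ H ∣ h ] Υ ∶ Ψ'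
permute pc p (hyp x)            = hyp (pc p x)
permute pc p (ax a q)           = ax a (↭-trans (↭-sym p) q)
permute pc p (down Γ Δ ne d q)  = down Γ Δ ne d (↭-trans (↭-sym p) q)
permute pc p (one q)            = one (↭-trans (↭-sym p) q)
permute pc p (tensor d e q)     = tensor d e (↭-trans (↭-sym p) q)
permute pc p (plusL d q)        = plusL d (↭-trans (↭-sym p) q)
permute pc p (plusR d q)        = plusR d (↭-trans (↭-sym p) q)
permute pc p (bang d q)         = bang d (↭-trans (↭-sym p) q)

mutual
  relax⊢ : ∀ {H h Υ Γ} → ⊢[ NoHyp ∣ h ] Υ ∶ Γ → ⊢[ H ∣ h ] Υ ∶ Γ
  relax⊢ (decide Φ Θ a b d q) = decide Φ Θ a b (relax⊨ d) q
  relax⊢ (bot d q)            = bot (relax⊢ d) q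
  relax⊢ (par d q)            = par (relax⊢ d) q
  relax⊢ (top q)              = top q
  relax⊢ (with' d e q)        = with' (relax⊢ d) (relax⊢ e) q
  relax⊢ (quest d q)          = quest (relax⊢ d) q

  relax⊨ : ∀ {H h Υ Ψ} → ⊨[ NoHyp ∣ h ] Υ ∶ Ψ → ⊨[ H ∣ h ] Υ ∶ Ψ
  relax⊨ (hyp ())
  relax⊨ (ax a q)          = ax a q
  relax⊨ (down Γ Δ ne d q) = down Γ Δ ne (relax⊢ d) q
  relax⊨ (one q)           = one q
  relax⊨ (tensor d e q)    = tensor (relax⊨ d) (relax⊨ e) q
  relax⊨ (plusL d q)       = plusL (relax⊨ d) q
  relax⊨ (plusR d q)       = plusR (relax⊨ d) q
  relax⊨ (bang d q)        = bang (relax⊢ d) q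

reheight : ∀ {H h h' Υ Ψ} → h ≡ h' → ⊨[ H ∣ h ] Υ ∶ Ψ → ⊨[ H ∣ h' ] Υ ∶ Ψ
reheight refl d = d

Grafting : ℕ → List Pos → List Item → List Item → Set₁
Grafting n Υ Σ' Ψ = ∀ {H} → PermClosed H → (Δ : List Item) → ∀ {k} →
                    ⊨[ H ∣ k ] Υ ∶ (Σ' ++ Δ) → ⊨[ H ∣ k + n ] Υ ∶ (Ψ ++ Δ)

graft-id : ∀ {Υ Ψ} → Grafting 0 Υ Ψ Ψ
graft-id _ _ {k} E = reheight (sym (+-identityʳ k)) E

graft-∘ : ∀ {m n Υ Ψ₀ Ψ₁ Ψ₂} →
          Grafting m Υ Ψ₀ Ψ₁ → Grafting n Υ Ψ₁ Ψ₂ → Grafting (m + n) Υ Ψ₀ Ψ₂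
graft-∘ {m} {n} f g pc Δ {k} E = reheight (+-assoc k m n) (g pc Δ (f pc Δ E))

graft-↭ : ∀ {n Υ Σ' Ψ Ψ'} → Ψ ↭ Ψ' → Grafting n Υ Σ' Ψ → Grafting n Υ Σ' Ψ'
graft-↭ p g pc Δ E = permute pc (++⁺ʳ Δ p) (g pc Δ E)

graft-frameʳ : ∀ {n Υ Σ' Ψ} → Grafting n Υ Σ' Ψ → ∀ Ξ →
               Grafting n Υ (Σ' ++ Ξ) (Ψ ++ Ξ)
graft-frameʳ {Σ' = Σ'} {Ψ} g Ξ pc Δ E =
  permute pc (↭-sym (++-assoc Ψ Ξ Δ)) (g pc (Ξ ++ Δ) (permute pc (++-assoc Σ' Ξ Δ) E))

graft-frameˡ : ∀ {n Υ Σ' Ψ} → ∀ Ξ → Grafting n Υ Σ' Ψ →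
               Grafting n Υ (Ξ ++ Σ') (Ξ ++ Ψ)
graft-frameˡ {Σ' = Σ'} {Ψ} Ξ g pc Δ E =
  permute pc (↭-trans (shifts Ψ Ξ) (↭-sym (++-assoc Ξ Ψ Δ)))
    (g pc (Ξ ++ Δ) (permute pc (↭-trans (++-assoc Ξ Σ' Δ) (shifts Ξ Σ')) E))

UnaryRule : List Pos → Pos → Pos → Set₁
UnaryRule Υ R R' = ∀ {H h Γ} → ⊨[ H ∣ h ] Υ ∶ (foc R ∷ Γ) → ⊨[ H ∣ suc h ] Υ ∶ (foc R' ∷ Γ)

graft-unary : ∀ {Υ R R'} → UnaryRule Υ R R' → Grafting 1 Υ [ foc R ] [ foc R' ]
graft-unary rule _ _ {k} E = reheight (+-comm 1 k) (rule E)

graft-tensorˡ : ∀ {hb Υ R S Ξ} → ⊨Proof hb Υ (foc S ∷ Ξ) →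
                Grafting (suc hb) Υ [ foc R ] (foc (R ⊗ S) ∷ Ξ)
graft-tensorˡ {hb} {Ξ = Ξ} db _ Δ {k} E =
  reheight (sym (+-suc k hb)) (tensor E (relax⊨ db) (prep _ (++-comm Ξ Δ)))

graft-tensorʳ : ∀ {ha Υ R S Ψa} → ⊨Proof ha Υ (foc R ∷ Ψa) →
                Grafting (suc ha) Υ [ foc S ] (foc (R ⊗ S) ∷ Ψa)
graft-tensorʳ {ha} {Ψa = Ψa} da _ Δ {k} E =
  reheight (trans (cong suc (+-comm ha k)) (sym (+-suc k ha))) (tensor (relax⊨ da) E ↭-refl)

record Extraction (h : ℕ) (Υ : List Pos) (Ψ : List Item) (P : Pos) : Set₁ where
  field
    Σ'     : List Item
    h₁ h₂  : ℕ
    spent  : Spent Σ'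
    proof  : ⊨Proof h₁ Υ (foc P ∷ Σ')
    graft  : Grafting h₂ Υ Σ' Ψ
    height : h₁ + h₂ ≡ h

open Extraction

reheight-extraction : ∀ {h h' Υ Ψ P} → h ≡ h' → Extraction h Υ Ψ P → Extraction h' Υ Ψ P
reheight-extraction refl x = x

extraction-↭ : ∀ {h Υ Ψ Ψ' P} → Ψ ↭ Ψ' → Extraction h Υ Ψ P → Extraction h Υ Ψ' P
extraction-↭ p x = record
  { Σ' = Σ' x ; h₁ = h₁ x ; h₂ = h₂ x ; spent = spent x ; proof = proof x
  ; graft = graft-↭ p (graft x) ; height = height x }

extraction-graft : ∀ {h n Υ Ψ Ψ' P} →
                   Extraction h Υ Ψ P → Grafting n Υ Ψ Ψ' → Extraction (h + n) Υ Ψ' P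
extraction-graft {n = n} x g = record
  { Σ'     = Σ' x
  ; h₁     = h₁ x
  ; h₂     = h₂ x + n
  ; spent  = spent x
  ; proof  = proof x
  ; graft  = graft-∘ (graft x) g
  ; height = trans (sym (+-assoc (h₁ x) (h₂ x) n)) (cong (_+ n) (height x))
  }

extraction-spent : ∀ {h Υ Ψ P} → ⊨Proof h Υ (foc P ∷ Ψ) → Spent Ψ → Extraction h Υ Ψ P
extraction-spent {h} {Ψ = Ψ} D sp = record
  { Σ' = Ψ ; h₁ = h ; h₂ = 0 ; spent = sp ; proof = D ; graft = graft-id
  ; height = +-identityʳ h }

-- Principal cases: the rule decomposing P itself joins the closed proof.
extraction-unary : ∀ {h Υ Ψ R R'} → UnaryRule Υ R R' →
                   Extraction h Υ Ψ R → Extraction (suc h) Υ Ψ R'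
extraction-unary rule x = record
  { Σ' = Σ' x ; h₁ = suc (h₁ x) ; h₂ = h₂ x ; spent = spent x ; proof = rule (proof x)
  ; graft = graft x ; height = cong suc (height x) }

extraction-tensor : ∀ {ha hb Υ Ψa Ξ R S} →
                    Extraction ha Υ Ψa R → Extraction hb Υ Ξ S →
                    Extraction (suc (ha + hb)) Υ (Ψa ++ Ξ) (R ⊗ S)
extraction-tensor {Ψa = Ψa} a b = record
  { Σ'     = Σ' a ++ Σ' b
  ; h₁     = suc (h₁ a + h₁ b)
  ; h₂     = h₂ a + h₂ b
  ; spent  = All.++⁺ (spent a) (spent b)
  ; proof  = tensor (proof a) (proof b) ↭-refl
  ; graft  = graft-∘ (graft-frameʳ (graft a) (Σ' b)) (graft-frameˡ Ψa (graft b))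
  ; height = cong suc (trans (interchange (h₁ a) (h₁ b) (h₂ a) (h₂ b))
                             (cong₂ _+_ (height a) (height b)))
  }

Extractor : ℕ → List Pos → List Item → Set₁
Extractor h Υ L = ∀ {Ψ P} → L ↭ foc P ∷ Ψ → Extraction h Υ Ψ P

extract-leaf : ∀ {h Υ L} → ⊨Proof h Υ L →
               (∀ {P Ψ} → L ↭ foc P ∷ Ψ → Spent Ψ) → Extractor h Υ L
extract-leaf D spent-beside e =
  extraction-spent (permute {H = NoHyp} (λ _ ()) e D) (spent-beside e)

-- Side case: P lies in the side context Γ of a rule whose premise focuses R;
-- the rule, as a grafting, is appended to the open part.
extraction-side : ∀ {h n Υ R Γ P rest Out} → Extractor h Υ (foc R ∷ Γ) →
                  Γ ↭ foc P ∷ rest → Grafting n Υ [ foc R ] Out →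
                  Extraction (h + n) Υ (Out ++ rest) P
extraction-side {R = R} {P = P} ext ρ step =
  extraction-graft (ext (↭-trans (prep (foc R) ρ) (swap (foc R) (foc P) ↭-refl)))
                   (graft-frameʳ step _)

extract-unary : ∀ {h Υ Γ R R'} → UnaryRule Υ R R' →
                Extractor h Υ (foc R ∷ Γ) → Extractor (suc h) Υ (foc R' ∷ Γ)
extract-unary rule ext e with ∈-resp-↭ (↭-sym e) (here refl)
... | here refl = extraction-↭ (drop-∷ e) (extraction-unary rule (ext ↭-refl))
... | there m with rest , ρ ← pick m =
  reheight-extraction (+-comm _ 1)
    (extraction-↭ (swap-out e ρ) (extraction-side ext ρ (graft-unary rule)))

-- ⊗ rule: P is principal, or it sits in the side context of one premise, in
-- which case the other premise is kept as part of the grafted ⊗ step.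
extract-tensor : ∀ {ha hb Υ Ψa Ξ R S} →
                 ⊨Proof ha Υ (foc R ∷ Ψa) → ⊨Proof hb Υ (foc S ∷ Ξ) →
                 Extractor ha Υ (foc R ∷ Ψa) → Extractor hb Υ (foc S ∷ Ξ) →
                 Extractor (suc (ha + hb)) Υ (foc (R ⊗ S) ∷ Ψa ++ Ξ)
extract-tensor {ha} {hb} {Ψa = Ψa} da db exa exb e with ∈-resp-↭ (↭-sym e) (here refl)
... | here refl = extraction-↭ (drop-∷ e) (extraction-tensor (exa ↭-refl) (exb ↭-refl))
... | there m with pick-++ Ψa m
...   | inj₁ (_ , ρ , σ) =
  reheight-extraction (+-suc ha hb)
    (extraction-↭ (swap-out e σ) (extraction-side exa ρ (graft-tensorˡ db)))
...   | inj₂ (_ , ρ , σ) =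
  reheight-extraction (trans (+-suc hb ha) (cong suc (+-comm hb ha)))
    (extraction-↭ (swap-out e σ) (extraction-side exb ρ (graft-tensorʳ da)))

extract : ∀ {h Υ L} → ⊨Proof h Υ L → Extractor h Υ L
extract (hyp ())
extract D@(ax a q) = extract-leaf D λ e →
  spent-beside-focus {Γ = [ natom a ]} (↭-trans (swap _ _ ↭-refl) (↭-trans (↭-sym q) e))
extract D@(down Γ Δ _ _ q) = extract-leaf D λ e →
  spent-remove (All-resp-↭ (↭-sym q) (spent-down Γ Δ)) e
extract D@(one q)    = extract-leaf D λ e → spent-beside-focus {Γ = []} (↭-trans (↭-sym q) e)
extract D@(bang _ q) = extract-leaf D λ e → spent-beside-focus {Γ = []} (↭-trans (↭-sym q) e)
extract (plusL d q) e = extract-unary (λ d' → plusL d' ↭-refl) (extract d) (↭-trans (↭-sym q) e)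
extract (plusR d q) e = extract-unary (λ d' → plusR d' ↭-refl) (extract d) (↭-trans (↭-sym q) e)
extract (tensor da db q) e =
  extract-tensor da db (extract da) (extract db) (↭-trans (↭-sym q) e)

-- The grafting, applied to the hypothesis leaf  ⊨ Υ : Σ, Δ, is the required
-- open derivation; the heights add up by construction.
mainTheorem1 : ∀ {h : ℕ} {Υ : List Pos} {Ψ : List Item} {P : Pos} →
    ⊨Proof h Υ (foc P ∷ Ψ) →
    Σ (List Item) λ Σ' → Σ ℕ λ h₁ → Σ ℕ λ h₂ →
      Spent Σ' ×
      ⊨Proof h₁ Υ (foc P ∷ Σ') ×
      ((Δ : List Neg) → OpenDeriv h₂ Υ (Σ' ++ map neg Δ) (Ψ ++ map neg Δ)) ×
      (h₁ + h₂ ≡ h)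
mainTheorem1 {h} {Υ} {Ψ} {P} D =
  Σ' x , h₁ x , h₂ x , spent x , proof x ,
  (λ Δ → graft x oneHyp-closed (map neg Δ) (hyp (refl , ↭-refl))) ,
  height x
  where
    x : Extraction h Υ Ψ P
    x = extract D ↭-refl
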